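{- Let $k,\sigma\ge1$. Every $(k,\sigma)$-covering string has length at least $$\max\left(\binom{\sigma+k-1}{k}+k-1,\ \sigma\cdot\left\lceil \binom{\sigma+k-1}{k-1}\Big/k\right\rceil\right).$$ In particular, a $(k,\sigma)$-PdB-string can only exist if $\binom{\sigma+k-1}{k}+k-1\ \ge\ \sigma\left\lceil\binom{\sigma+k-1}{k-1}\big/k\right\rceil$.
   Context: Let $\Sigma=\{a_1<\dots<a_\sigma\}$. For a string $u$, $\mathbf{pv}(u)\in\mathbb{N}^\sigma$ has $i$-th entry the number of occurrences of $a_i$ in $u$; the order of a Parikh vector is the sum of its entries. A string $w$ over $\Sigma$ is $(k,\sigma)$-covering if for every Parikh vector $p\in\mathbb{N}^\sigma$ of order $k$ there is a substring $u$ of $w$ with $\mathbf{pv}(u)=p$. It is a $(k,\sigma)$-PdB-string (Parikh-de-Bruijn string) if for every Parikh vector $p$ of order $k$ there is exactly one (occurrence of a) length-$k$ substring $u$ of $w$ with $\mathbf{pv}(u)=p$. -}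

module Defs where

open import Data.Nat using (ℕ; zero; suc; _+_; _*_; _≤_; _/_)
open import Data.Fin using (Fin)
open import Data.Fin.Properties using (_≟_)
open import Data.List using (List; length; filter; take; drop; _++_)
open import Data.Vec using (Vec; tabulate; sum)
open import Data.Product using (Σ; ∃; ∃-syntax; _×_)
open import Relation.Binary.PropositionalEquality using (_≡_)

Str : ℕ → Set
Str σ = List (Fin σ)

PV : ℕ → Set
PV σ = Vec ℕ σ

occ : ∀ {σ} → Fin σ → Str σ → ℕ
occ a u = length (filter (a ≟_) u)

pv : ∀ {σ} → Str σ → PV σ
pv u = tabulate (λ i → occ i u)

order : ∀ {σ} → PV σ → ℕ
order p = sum p

Substring : ∀ {σ} → Str σ → Str σ → Set
Substring u w = ∃[ x ] ∃[ y ] (w ≡ x ++ u ++ y)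

Covering : (k σ : ℕ) → Str σ → Set
Covering k σ w = (p : PV σ) → order p ≡ k → ∃[ u ] (Substring u w × pv u ≡ p)

OccAt : ∀ {σ} (k : ℕ) → Str σ → PV σ → ℕ → Set
OccAt k w p i = (i + k ≤ length w) × (pv (take k (drop i w)) ≡ p)

PdB : (k σ : ℕ) → Str σ → Set
PdB k σ w = (p : PV σ) → order p ≡ k →
  ∃[ i ] (OccAt k w p i × (∀ j → OccAt k w p j → j ≡ i))

-- ceiling division ⌈a / b⌉ (only used with b ≥ 1; value 0 for b = 0)
ceilDiv : ℕ → ℕ → ℕ
ceilDiv a zero    = 0
ceilDiv a (suc m) = (a + m) / suc m

-- A covering string w of length n has only n − k + 1 windows of length k, and each of the
-- C(σ+k−1, k) Parikh vectors of order k must be the Parikh vector of one of them.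
-- For the second bound fix a letter a. Summed over all Parikh vectors of order k, the a-entries
-- add up to C(σ+k−1, k−1) (a Pascal-rule induction); summed over the windows of w they add up to
-- at most k·|w|_a, because every occurrence of a lies in at most k windows. Hence
-- |w|_a ≥ ⌈C(σ+k−1, k−1)/k⌉ for each of the σ letters.
-- In a PdB-string the windows have pairwise distinct Parikh vectors of order k, so there are at
-- most C(σ+k−1, k) of them; being covering as well, it satisfies both bounds.
module Submission where

open import Defs
open import Data.Empty using (⊥-elim)
open import Data.Fin using (Fin; zero; suc)
open import Data.Fin.Properties using (_≟_)
open import Data.List
  using (List; []; _∷_; [_]; _++_; length; filter; take; drop; map; applyUpTo)
open import Data.List.Membership.Propositional using (_∈_)
open import Data.List.Membership.Propositional.Properties
  using (∈-map⁺; ∈-map⁻; ∈-++⁺ˡ; ∈-++⁺ʳ; ∈-++⁻; ∈-∃++; ∈-applyUpTo⁺; ∈-applyUpTo⁻)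
open import Data.List.Properties
  using (length-++; length-++-≤ˡ; length-map; length-applyUpTo; length-take; length-drop;
         map-++; map-∘; filter-++; take-[]; take++drop≡id)
open import Data.List.Relation.Binary.Subset.Propositional using (_⊆_)
open import Data.List.Relation.Unary.Any using (here; there)
open import Data.List.Relation.Unary.All using ([])
import Data.List.Relation.Unary.All as All
open import Data.List.Relation.Unary.AllPairs using ([]; _∷_)
open import Data.List.Relation.Unary.Unique.Propositional using (Unique)
open import Data.List.Relation.Unary.Unique.Propositional.Properties as Unique
  using (applyUpTo⁺₁)
open import Data.Nat using (ℕ; zero; suc; _+_; _*_; _∸_; _≤_; _<_; _⊔_; _⊓_; z≤n; s≤s)
open import Data.Nat.Combinatorics using (_C_; nCn≡1; nCk+nC[k+1]≡[n+1]C[k+1])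
open import Data.Nat.DivMod using (m<n*o⇒m/o<n)
open import Data.Nat.ListAction using (sum)
open import Data.Nat.ListAction.Properties using (sum-++)
open import Data.Nat.Properties hiding (_≟_)
open import Data.Product using (_,_; _×_)
open import Data.Sum using (inj₁; inj₂)
open import Data.Vec using (tabulate; lookup)
  renaming ([] to []ᵥ; _∷_ to _∷ᵥ_)
open import Data.Vec.Properties using (∷-injectiveʳ; tabulate-cong; lookup∘tabulate)
open import Function using (_∘_)
open import Algebra.Properties.CommutativeSemigroup +-commutativeSemigroup
  using (interchange; x∙yz≈y∙xz)
open import Relation.Nullary using (¬_; yes; no)
open import Relation.Binary.PropositionalEquality
  using (_≡_; _≢_; refl; sym; trans; cong; cong₂; subst; module ≡-Reasoning)

occ-++ : ∀ {σ} (a : Fin σ) (u v : Str σ) → occ a (u ++ v) ≡ occ a u + occ a v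
occ-++ a u v = trans (cong length (filter-++ (a ≟_) u v)) (length-++ (filter (a ≟_) u))

occ-≤-∷ : ∀ {σ} (a c : Fin σ) (u : Str σ) → occ a u ≤ occ a (c ∷ u)
occ-≤-∷ a c u = ≤-trans (m≤n+m (occ a u) (occ a [ c ])) (≤-reflexive (sym (occ-++ a [ c ] u)))

occ-suc-[suc] : ∀ {σ} (a c : Fin σ) → occ (suc a) [ suc c ] ≡ occ a [ c ]
occ-suc-[suc] a c with a ≟ c
... | yes _ = refl
... | no _  = refl

order-tabulate-+ : ∀ {σ} (f g : Fin σ → ℕ) →
  order (tabulate (λ i → f i + g i)) ≡ order (tabulate f) + order (tabulate g)
order-tabulate-+ {zero}  f g = refl
order-tabulate-+ {suc σ} f g = begin
    f zero + g zero + order (tabulate (λ i → f (suc i) + g (suc i)))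
  ≡⟨ cong (f zero + g zero +_) (order-tabulate-+ (f ∘ suc) (g ∘ suc)) ⟩
    f zero + g zero + (order (tabulate (f ∘ suc)) + order (tabulate (g ∘ suc)))
  ≡⟨ interchange (f zero) (g zero) _ _ ⟩
    order (tabulate f) + order (tabulate g) ∎
  where open ≡-Reasoning

order-pv-[] : ∀ {σ} → order (pv {σ} []) ≡ 0
order-pv-[] {zero}  = refl
order-pv-[] {suc σ} = order-pv-[] {σ}

order-pv-singleton : ∀ {σ} (c : Fin σ) → order (pv [ c ]) ≡ 1
order-pv-singleton {suc σ} zero    = cong suc (order-pv-[] {σ})
order-pv-singleton {suc σ} (suc c) =
  trans (cong order (tabulate-cong (λ i → occ-suc-[suc] i c))) (order-pv-singleton c)

order-pv : ∀ {σ} (u : Str σ) → order (pv u) ≡ length u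
order-pv {σ} []      = order-pv-[] {σ}
order-pv {σ} (c ∷ u) = begin
    order (tabulate (λ i → occ i (c ∷ u)))
  ≡⟨ cong order (tabulate-cong (λ i → occ-++ i [ c ] u)) ⟩
    order (tabulate (λ i → occ i [ c ] + occ i u))
  ≡⟨ order-tabulate-+ (λ i → occ i [ c ]) (λ i → occ i u) ⟩
    order (pv [ c ]) + order (pv u)
  ≡⟨ cong₂ _+_ (order-pv-singleton c) (order-pv u) ⟩
    suc (length u) ∎
  where open ≡-Reasoning

sucHead : ∀ {σ} → PV (suc σ) → PV (suc σ)
sucHead (x ∷ᵥ p) = suc x ∷ᵥ p

sucHead-injective : ∀ {σ} {p q : PV (suc σ)} → sucHead p ≡ sucHead q → p ≡ q
sucHead-injective {p = _ ∷ᵥ _} {_ ∷ᵥ _} refl = refl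

parikhVectors : (σ k : ℕ) → List (PV σ)
parikhVectors zero    zero    = [ []ᵥ ]
parikhVectors zero    (suc k) = []
parikhVectors (suc σ) zero    = map (0 ∷ᵥ_) (parikhVectors σ zero)
parikhVectors (suc σ) (suc k) =
  map (0 ∷ᵥ_) (parikhVectors σ (suc k)) ++ map sucHead (parikhVectors (suc σ) k)

∈-parikhVectors⁺ : ∀ {σ k} (p : PV σ) → order p ≡ k → p ∈ parikhVectors σ k
∈-parikhVectors⁺ {zero}  {zero}  []ᵥ           _  = here refl
∈-parikhVectors⁺ {suc σ} {zero}  (zero ∷ᵥ q)   eq = ∈-map⁺ (0 ∷ᵥ_) (∈-parikhVectors⁺ q eq)
∈-parikhVectors⁺ {suc σ} {suc k} (zero ∷ᵥ q)   eq =
  ∈-++⁺ˡ (∈-map⁺ (0 ∷ᵥ_) (∈-parikhVectors⁺ q eq))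
∈-parikhVectors⁺ {suc σ} {suc k} (suc x ∷ᵥ q) eq =
  ∈-++⁺ʳ _ (∈-map⁺ sucHead (∈-parikhVectors⁺ (x ∷ᵥ q) (suc-injective eq)))

∈-parikhVectors⁻ : ∀ {σ k} {p : PV σ} → p ∈ parikhVectors σ k → order p ≡ k
∈-parikhVectors⁻ {zero}  {zero}  (here refl) = refl
∈-parikhVectors⁻ {suc σ} {zero}  p∈ with ∈-map⁻ (0 ∷ᵥ_) p∈
... | _ , q∈ , refl = ∈-parikhVectors⁻ q∈
∈-parikhVectors⁻ {suc σ} {suc k} p∈ with ∈-++⁻ (map (0 ∷ᵥ_) (parikhVectors σ (suc k))) p∈
... | inj₁ p∈₁ with ∈-map⁻ (0 ∷ᵥ_) p∈₁
...   | _ , q∈ , refl = ∈-parikhVectors⁻ q∈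
∈-parikhVectors⁻ {suc σ} {suc k} p∈ | inj₂ p∈₂ with ∈-map⁻ sucHead p∈₂
...   | _ ∷ᵥ _ , q∈ , refl = cong suc (∈-parikhVectors⁻ q∈)

parikhVectors-unique : ∀ σ k → Unique (parikhVectors σ k)
parikhVectors-unique zero    zero    = [] ∷ []
parikhVectors-unique zero    (suc k) = []
parikhVectors-unique (suc σ) zero    = Unique.map⁺ ∷-injectiveʳ (parikhVectors-unique σ zero)
parikhVectors-unique (suc σ) (suc k) =
  Unique.++⁺ (Unique.map⁺ ∷-injectiveʳ (parikhVectors-unique σ (suc k)))
             (Unique.map⁺ sucHead-injective (parikhVectors-unique (suc σ) k))
             disjoint
  where
  disjoint : ∀ {p} →
    ¬ (p ∈ map (0 ∷ᵥ_) (parikhVectors σ (suc k)) × p ∈ map sucHead (parikhVectors (suc σ) k))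
  disjoint (p∈₁ , p∈₂) with ∈-map⁻ (0 ∷ᵥ_) p∈₁ | ∈-map⁻ sucHead p∈₂
  ... | _ , _ , refl | _ ∷ᵥ _ , _ , ()

length-parikhVectors-zero : ∀ σ → length (parikhVectors σ 0) ≡ 1
length-parikhVectors-zero zero    = refl
length-parikhVectors-zero (suc σ) =
  trans (length-map (0 ∷ᵥ_) (parikhVectors σ 0)) (length-parikhVectors-zero σ)

length-parikhVectors-suc : ∀ σ k → length (parikhVectors (suc σ) (suc k)) ≡
  length (parikhVectors σ (suc k)) + length (parikhVectors (suc σ) k)
length-parikhVectors-suc σ k = begin
    length (map (0 ∷ᵥ_) (parikhVectors σ (suc k)) ++ map sucHead (parikhVectors (suc σ) k))
  ≡⟨ length-++ (map (0 ∷ᵥ_) (parikhVectors σ (suc k))) ⟩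
    length (map (0 ∷ᵥ_) (parikhVectors σ (suc k))) + length (map sucHead (parikhVectors (suc σ) k))
  ≡⟨ cong₂ _+_ (length-map _ (parikhVectors σ (suc k))) (length-map _ (parikhVectors (suc σ) k)) ⟩
    length (parikhVectors σ (suc k)) + length (parikhVectors (suc σ) k) ∎
  where open ≡-Reasoning

length-parikhVectors : ∀ s k → length (parikhVectors (suc s) k) ≡ (s + k) C k
length-parikhVectors s       zero    = length-parikhVectors-zero (suc s)
length-parikhVectors zero    (suc k) = begin
    length (parikhVectors 1 (suc k))  ≡⟨ length-parikhVectors-suc 0 k ⟩
    length (parikhVectors 1 k)        ≡⟨ length-parikhVectors zero k ⟩
    k C k                             ≡⟨ trans (nCn≡1 k) (sym (nCn≡1 (suc k))) ⟩
    suc k C suc k                     ∎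
  where open ≡-Reasoning
length-parikhVectors (suc s) (suc k) = begin
    length (parikhVectors (suc (suc s)) (suc k))
  ≡⟨ length-parikhVectors-suc (suc s) k ⟩
    length (parikhVectors (suc s) (suc k)) + length (parikhVectors (suc (suc s)) k)
  ≡⟨ cong₂ _+_ (length-parikhVectors s (suc k)) (length-parikhVectors (suc s) k) ⟩
    (s + suc k) C suc k + (suc s + k) C k
  ≡⟨ cong (λ n → (s + suc k) C suc k + n C k) (sym (+-suc s k)) ⟩
    (s + suc k) C suc k + (s + suc k) C k
  ≡⟨ +-comm ((s + suc k) C suc k) _ ⟩
    (s + suc k) C k + (s + suc k) C suc k
  ≡⟨ nCk+nC[k+1]≡[n+1]C[k+1] (s + suc k) k ⟩
    suc (s + suc k) C suc k ∎
  where open ≡-Reasoning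

entrySum : ∀ {σ} → Fin σ → List (PV σ) → ℕ
entrySum a ps = sum (map (λ p → lookup p a) ps)

entrySum-++ : ∀ {σ} (a : Fin σ) ps qs → entrySum a (ps ++ qs) ≡ entrySum a ps + entrySum a qs
entrySum-++ a ps qs =
  trans (cong sum (map-++ (λ p → lookup p a) ps qs)) (sum-++ (map (λ p → lookup p a) ps) _)

entrySum-zero-0∷ : ∀ {σ} (ps : List (PV σ)) → entrySum zero (map (0 ∷ᵥ_) ps) ≡ 0
entrySum-zero-0∷ []       = refl
entrySum-zero-0∷ (p ∷ ps) = entrySum-zero-0∷ ps

entrySum-suc-0∷ : ∀ {σ} (a : Fin σ) ps → entrySum (suc a) (map (0 ∷ᵥ_) ps) ≡ entrySum a ps
entrySum-suc-0∷ a ps = cong sum (sym (map-∘ ps))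

entrySum-zero-sucHead : ∀ {σ} (ps : List (PV (suc σ))) →
  entrySum zero (map sucHead ps) ≡ length ps + entrySum zero ps
entrySum-zero-sucHead []              = refl
entrySum-zero-sucHead ((x ∷ᵥ p) ∷ ps) =
  cong suc (trans (cong (x +_) (entrySum-zero-sucHead ps)) (x∙yz≈y∙xz x (length ps) _))

entrySum-suc-sucHead : ∀ {σ} (a : Fin σ) ps →
  entrySum (suc a) (map sucHead ps) ≡ entrySum (suc a) ps
entrySum-suc-sucHead a []              = refl
entrySum-suc-sucHead a ((x ∷ᵥ p) ∷ ps) = cong (lookup p a +_) (entrySum-suc-sucHead a ps)

entrySum-parikhVectors-zero : ∀ {σ} (a : Fin σ) → entrySum a (parikhVectors σ 0) ≡ 0
entrySum-parikhVectors-zero {suc σ} zero    = entrySum-zero-0∷ (parikhVectors σ 0)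
entrySum-parikhVectors-zero {suc σ} (suc a) =
  trans (entrySum-suc-0∷ a (parikhVectors σ 0)) (entrySum-parikhVectors-zero a)

-- Proved simultaneously with the order-shifted form below, which holds also for order 0 and is
-- what Pascal's rule turns the induction hypothesis into.
entrySum-parikhVectors : ∀ s k (a : Fin (suc s)) →
  entrySum a (parikhVectors (suc s) (suc k)) ≡ (s + suc k) C k
binomial+entrySum-parikhVectors : ∀ s k (a : Fin (suc s)) →
  (s + k) C k + entrySum a (parikhVectors (suc s) k) ≡ (s + suc k) C k

entrySum-parikhVectors s k zero = begin
    entrySum zero (map (0 ∷ᵥ_) P ++ map sucHead Q)
  ≡⟨ entrySum-++ zero (map (0 ∷ᵥ_) P) (map sucHead Q) ⟩
    entrySum zero (map (0 ∷ᵥ_) P) + entrySum zero (map sucHead Q)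
  ≡⟨ cong₂ _+_ (entrySum-zero-0∷ P) (entrySum-zero-sucHead Q) ⟩
    length Q + entrySum zero Q
  ≡⟨ cong (_+ entrySum zero Q) (length-parikhVectors s k) ⟩
    (s + k) C k + entrySum zero Q
  ≡⟨ binomial+entrySum-parikhVectors s k zero ⟩
    (s + suc k) C k ∎
  where
  open ≡-Reasoning
  P : List (PV s)
  P = parikhVectors s (suc k)
  Q : List (PV (suc s))
  Q = parikhVectors (suc s) k
entrySum-parikhVectors (suc s) k (suc a) = begin
    entrySum (suc a) (map (0 ∷ᵥ_) P ++ map sucHead Q)
  ≡⟨ entrySum-++ (suc a) (map (0 ∷ᵥ_) P) (map sucHead Q) ⟩
    entrySum (suc a) (map (0 ∷ᵥ_) P) + entrySum (suc a) (map sucHead Q)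
  ≡⟨ cong₂ _+_ (entrySum-suc-0∷ a P) (entrySum-suc-sucHead a Q) ⟩
    entrySum a P + entrySum (suc a) Q
  ≡⟨ cong (_+ entrySum (suc a) Q) (trans (entrySum-parikhVectors s k a) (cong (_C k) (+-suc s k))) ⟩
    (suc s + k) C k + entrySum (suc a) Q
  ≡⟨ binomial+entrySum-parikhVectors (suc s) k (suc a) ⟩
    (suc s + suc k) C k ∎
  where
  open ≡-Reasoning
  P : List (PV (suc s))
  P = parikhVectors (suc s) (suc k)
  Q : List (PV (suc (suc s)))
  Q = parikhVectors (suc (suc s)) k

binomial+entrySum-parikhVectors s zero    a = cong suc (entrySum-parikhVectors-zero a)
binomial+entrySum-parikhVectors s (suc k) a = begin
    (s + suc k) C suc k + entrySum a (parikhVectors (suc s) (suc k))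
  ≡⟨ cong ((s + suc k) C suc k +_) (entrySum-parikhVectors s k a) ⟩
    (s + suc k) C suc k + (s + suc k) C k
  ≡⟨ +-comm ((s + suc k) C suc k) _ ⟩
    (s + suc k) C k + (s + suc k) C suc k
  ≡⟨ nCk+nC[k+1]≡[n+1]C[k+1] (s + suc k) k ⟩
    suc (s + suc k) C suc k
  ≡⟨ cong (_C suc k) (sym (+-suc s (suc k))) ⟩
    (s + suc (suc k)) C suc k ∎
  where open ≡-Reasoning

window : ∀ {σ} → ℕ → Str σ → ℕ → Str σ
window k w i = take k (drop i w)

-- One entry per starting position, repetitions kept: PdB-uniqueness says this list is Unique.
windowPVs : ∀ {σ} → ℕ → Str σ → List (PV σ)
windowPVs k w = applyUpTo (pv ∘ window k w) (suc (length w) ∸ k)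

take-length-++ : ∀ {A : Set} (u v : List A) → take (length u) (u ++ v) ≡ u
take-length-++ []      v = refl
take-length-++ (c ∷ u) v = cong (c ∷_) (take-length-++ u v)

window-++ : ∀ {σ} (x u y : Str σ) → window (length u) (x ++ u ++ y) (length x) ≡ u
window-++ []      u y = take-length-++ u y
window-++ (c ∷ x) u y = window-++ x u y

i<1+n∸k⇒i+k≤n : ∀ {i k n} → i < suc n ∸ k → i + k ≤ n
i<1+n∸k⇒i+k≤n {i} {k} {n} i<n′ = ≤-pred (m≤o∸n⇒m+n≤o (suc i) k≤1+n i<n′)
  where
  k≤1+n : k ≤ suc n
  k≤1+n = <⇒≤ (m∸n≢0⇒n<m (n>0⇒n≢0 (≤-trans (s≤s z≤n) i<n′)))

length-window : ∀ {σ} {i k} (w : Str σ) → i + k ≤ length w → length (window k w i) ≡ k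
length-window {i = i} {k} w i+k≤ = begin
    length (take k (drop i w))  ≡⟨ length-take k (drop i w) ⟩
    k ⊓ length (drop i w)       ≡⟨ cong (k ⊓_) (length-drop i w) ⟩
    k ⊓ (length w ∸ i)          ≡⟨ m≤n⇒m⊓n≡m (m+n≤o⇒m≤o∸n k (subst (_≤ length w) (+-comm i k) i+k≤)) ⟩
    k                           ∎
  where open ≡-Reasoning

order-pv-window : ∀ {σ} {i k} (w : Str σ) → i + k ≤ length w → order (pv (window k w i)) ≡ k
order-pv-window {i = i} {k} w i+k≤ = trans (order-pv (window k w i)) (length-window w i+k≤)

window-substring : ∀ {σ} k (w : Str σ) i → Substring (window k w i) w
window-substring k w i = take i w , drop k (drop i w) , sym (begin
    take i w ++ take k (drop i w) ++ drop k (drop i w)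
  ≡⟨ cong (take i w ++_) (take++drop≡id k (drop i w)) ⟩
    take i w ++ drop i w
  ≡⟨ take++drop≡id i w ⟩
    w ∎)
  where open ≡-Reasoning

Substring⇒∈windowPVs : ∀ {σ} {u w : Str σ} → Substring u w → pv u ∈ windowPVs (length u) w
Substring⇒∈windowPVs {u = u} (x , y , refl) =
  subst (λ v → pv v ∈ windowPVs (length u) (x ++ u ++ y)) (window-++ x u y)
        (∈-applyUpTo⁺ (pv ∘ window (length u) (x ++ u ++ y)) x<n′)
  where
  x<n′ : length x < suc (length (x ++ u ++ y)) ∸ length u
  x<n′ = m+n≤o⇒m≤o∸n (suc (length x))
           (s≤s (≤-trans (+-monoʳ-≤ (length x) (length-++-≤ˡ u)) (≤-reflexive (sym (length-++ x)))))

windowPVs⊆parikhVectors : ∀ {σ} k (w : Str σ) → windowPVs k w ⊆ parikhVectors σ k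
windowPVs⊆parikhVectors k w p∈ with ∈-applyUpTo⁻ (pv ∘ window k w) p∈
... | i , i<n′ , refl =
  ∈-parikhVectors⁺ _ (order-pv-window w (i<1+n∸k⇒i+k≤n i<n′))

-- Also counts the truncated windows at the end of w; this is what makes slidingOcc-suc exact.
slidingOcc : ∀ {σ} → Fin σ → ℕ → Str σ → ℕ
slidingOcc a k []      = 0
slidingOcc a k (c ∷ w) = occ a (take k (c ∷ w)) + slidingOcc a k w

slidingOcc-suc : ∀ {σ} (a : Fin σ) k c w →
  slidingOcc a (suc k) (c ∷ w) ≡ occ a (c ∷ w) + slidingOcc a k w
slidingOcc-suc a k c []      = cong (λ v → occ a (c ∷ v) + 0) (take-[] k)
slidingOcc-suc a k c (d ∷ w) = begin
    occ a (c ∷ take k (d ∷ w)) + slidingOcc a (suc k) (d ∷ w)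
  ≡⟨ cong₂ _+_ (occ-++ a [ c ] (take k (d ∷ w))) (slidingOcc-suc a k d w) ⟩
    occ a [ c ] + occ a (take k (d ∷ w)) + (occ a (d ∷ w) + slidingOcc a k w)
  ≡⟨ interchange (occ a [ c ]) _ _ _ ⟩
    occ a [ c ] + occ a (d ∷ w) + (occ a (take k (d ∷ w)) + slidingOcc a k w)
  ≡⟨ cong (_+ slidingOcc a k (d ∷ w)) (occ-++ a [ c ] (d ∷ w)) ⟨
    occ a (c ∷ d ∷ w) + slidingOcc a k (d ∷ w) ∎
  where open ≡-Reasoning

slidingOcc-≤ : ∀ {σ} (a : Fin σ) k w → slidingOcc a k w ≤ k * occ a w
slidingOcc-≤ a zero    []      = z≤n
slidingOcc-≤ a zero    (c ∷ w) = slidingOcc-≤ a zero w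
slidingOcc-≤ a (suc k) []      = z≤n
slidingOcc-≤ a (suc k) (c ∷ w) = begin
    slidingOcc a (suc k) (c ∷ w)      ≡⟨ slidingOcc-suc a k c w ⟩
    occ a (c ∷ w) + slidingOcc a k w  ≤⟨ +-monoʳ-≤ (occ a (c ∷ w)) (slidingOcc-≤ a k w) ⟩
    occ a (c ∷ w) + k * occ a w       ≤⟨ +-monoʳ-≤ (occ a (c ∷ w)) (*-monoʳ-≤ k (occ-≤-∷ a c w)) ⟩
    suc k * occ a (c ∷ w)             ∎
  where open ≤-Reasoning

entrySum-windows-≤-slidingOcc : ∀ {σ} (a : Fin σ) k w {n} → n ≤ length w →
  entrySum a (applyUpTo (pv ∘ window k w) n) ≤ slidingOcc a k w
entrySum-windows-≤-slidingOcc a k w       {zero}  _         = z≤n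
entrySum-windows-≤-slidingOcc a k (c ∷ w) {suc n} (s≤s n≤) =
  +-mono-≤ (≤-reflexive (lookup∘tabulate (λ i → occ i (take k (c ∷ w))) a))
           (entrySum-windows-≤-slidingOcc a k w n≤)

entrySum-windowPVs-≤ : ∀ {σ} (a : Fin σ) m w → entrySum a (windowPVs (suc m) w) ≤ suc m * occ a w
entrySum-windowPVs-≤ a m w =
  ≤-trans (entrySum-windows-≤-slidingOcc a (suc m) w (m∸n≤m (length w) m))
          (slidingOcc-≤ a (suc m) w)

module _ {A : Set} where

  ∈-remove : ∀ {v x : A} ys zs → v ∈ ys ++ x ∷ zs → v ≢ x → v ∈ ys ++ zs
  ∈-remove ys zs v∈ v≢x with ∈-++⁻ ys v∈
  ... | inj₁ v∈ys         = ∈-++⁺ˡ v∈ys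
  ... | inj₂ (here v≡x)   = ⊥-elim (v≢x v≡x)
  ... | inj₂ (there v∈zs) = ∈-++⁺ʳ ys v∈zs

  sum-map-insert : ∀ (f : A → ℕ) x ys zs → sum (map f (ys ++ x ∷ zs)) ≡ f x + sum (map f (ys ++ zs))
  sum-map-insert f x ys zs = begin
      sum (map f (ys ++ x ∷ zs))              ≡⟨ cong sum (map-++ f ys (x ∷ zs)) ⟩
      sum (map f ys ++ f x ∷ map f zs)        ≡⟨ sum-++ (map f ys) (f x ∷ map f zs) ⟩
      sum (map f ys) + (f x + sum (map f zs)) ≡⟨ x∙yz≈y∙xz (sum (map f ys)) (f x) _ ⟩
      f x + (sum (map f ys) + sum (map f zs)) ≡⟨ cong (f x +_) (sum-++ (map f ys) (map f zs)) ⟨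
      f x + sum (map f ys ++ map f zs)        ≡⟨ cong (λ l → f x + sum l) (map-++ f ys zs) ⟨
      f x + sum (map f (ys ++ zs))            ∎
    where open ≡-Reasoning

  sum-map-mono-⊆ : ∀ (f : A → ℕ) {xs ys} → Unique xs → xs ⊆ ys → sum (map f xs) ≤ sum (map f ys)
  sum-map-mono-⊆ f {[]}     _            _     = z≤n
  sum-map-mono-⊆ f {x ∷ xs} (x∉xs ∷ !xs) xs⊆ys with ∈-∃++ (xs⊆ys (here refl))
  ... | ys , zs , refl =
    ≤-trans (+-monoʳ-≤ (f x) (sum-map-mono-⊆ f !xs xs⊆ys++zs))
            (≤-reflexive (sym (sum-map-insert f x ys zs)))
    where
    xs⊆ys++zs : xs ⊆ ys ++ zs
    xs⊆ys++zs v∈ = ∈-remove ys zs (xs⊆ys (there v∈)) (λ v≡x → All.lookup x∉xs v∈ (sym v≡x))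

  sum-map-const-1 : ∀ (xs : List A) → sum (map (λ _ → 1) xs) ≡ length xs
  sum-map-const-1 []       = refl
  sum-map-const-1 (x ∷ xs) = cong suc (sum-map-const-1 xs)

  length-mono-⊆ : ∀ {xs ys : List A} → Unique xs → xs ⊆ ys → length xs ≤ length ys
  length-mono-⊆ {xs} {ys} !xs xs⊆ys = begin
    length xs                 ≡⟨ sum-map-const-1 xs ⟨
    sum (map (λ _ → 1) xs)    ≤⟨ sum-map-mono-⊆ (λ _ → 1) !xs xs⊆ys ⟩
    sum (map (λ _ → 1) ys)    ≡⟨ sum-map-const-1 ys ⟩
    length ys                 ∎
    where open ≤-Reasoning

k≤n⇒nCk>0 : ∀ {n k} → k ≤ n → 0 < n C k
k≤n⇒nCk>0 {n}     {zero}  _         = s≤s z≤n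
k≤n⇒nCk>0 {suc n} {suc k} (s≤s k≤n) =
  ≤-trans (k≤n⇒nCk>0 k≤n) (≤-trans (m≤m+n (n C k) _) (≤-reflexive (nCk+nC[k+1]≡[n+1]C[k+1] n k)))

ceilDiv-≤ : ∀ {m n o} → m ≤ o * suc n → ceilDiv m (suc n) ≤ o
ceilDiv-≤ {m} {n} {o} m≤ =
  m<1+n⇒m≤n (m<n*o⇒m/o<n {m + n} {suc o}
    (s≤s (subst (_≤ n + o * suc n) (+-comm n m) (+-monoʳ-≤ n m≤))))

order-tabulate-≥ : ∀ {σ c} (f : Fin σ → ℕ) → (∀ i → c ≤ f i) → σ * c ≤ order (tabulate f)
order-tabulate-≥ {zero}  f c≤f = z≤n
order-tabulate-≥ {suc σ} f c≤f = +-mono-≤ (c≤f zero) (order-tabulate-≥ (f ∘ suc) (c≤f ∘ suc))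

module _ {k σ : ℕ} {w : Str σ} where

  Covering⇒parikhVectors⊆windowPVs : Covering k σ w → parikhVectors σ k ⊆ windowPVs k w
  Covering⇒parikhVectors⊆windowPVs cov {p} p∈ with cov p (∈-parikhVectors⁻ p∈)
  ... | u , u⊑w , refl =
    subst (λ n → pv u ∈ windowPVs n w) (trans (sym (order-pv u)) (∈-parikhVectors⁻ p∈))
          (Substring⇒∈windowPVs u⊑w)

  PdB⇒Covering : PdB k σ w → Covering k σ w
  PdB⇒Covering pdb p order≡k with pdb p order≡k
  ... | i , (_ , pv≡p) , _ = window k w i , window-substring k w i , pv≡p

  PdB⇒OccAt-unique : PdB k σ w → ∀ {p i j} → OccAt k w p i → OccAt k w p j → i ≡ j
  PdB⇒OccAt-unique pdb occᵢ@(i+k≤ , refl) occⱼ with pdb _ (order-pv-window w i+k≤)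
  ... | _ , _ , unique = trans (unique _ occᵢ) (sym (unique _ occⱼ))

  PdB⇒Unique-windowPVs : PdB k σ w → Unique (windowPVs k w)
  PdB⇒Unique-windowPVs pdb = applyUpTo⁺₁ (pv ∘ window k w) _ distinct
    where
    distinct : ∀ {i j} → i < j → j < suc (length w) ∸ k → pv (window k w i) ≢ pv (window k w j)
    distinct {i} {j} i<j j<n′ pvᵢ≡pvⱼ =
      <⇒≢ i<j (PdB⇒OccAt-unique pdb (i+k≤ , refl) (j+k≤ , sym pvᵢ≡pvⱼ))
      where
      j+k≤ : j + k ≤ length w
      j+k≤ = i<1+n∸k⇒i+k≤n j<n′
      i+k≤ : i + k ≤ length w
      i+k≤ = ≤-trans (+-monoˡ-≤ k (<⇒≤ i<j)) j+k≤

module _ {s m : ℕ} {w : Str (suc s)} where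

  private
    V : List (PV (suc s))
    V = parikhVectors (suc s) (suc m)

    V-unique : Unique V
    V-unique = parikhVectors-unique (suc s) (suc m)

  Covering⇒binomial+m≤length : Covering (suc m) (suc s) w → (s + suc m) C suc m + m ≤ length w
  Covering⇒binomial+m≤length cov = m≤o∸n⇒m+n≤o _ m≤∣w∣ binomial≤
    where
    binomial≤ : (s + suc m) C suc m ≤ length w ∸ m
    binomial≤ = begin
      (s + suc m) C suc m                        ≡⟨ length-parikhVectors s (suc m) ⟨
      length V                                   ≤⟨ length-mono-⊆ V-unique
                                                      (Covering⇒parikhVectors⊆windowPVs cov) ⟩
      length (windowPVs (suc m) w)               ≡⟨ length-applyUpTo _ _ ⟩
      length w ∸ m                               ∎
      where open ≤-Reasoning
    m≤∣w∣ : m ≤ length w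
    m≤∣w∣ = <⇒≤ (m∸n≢0⇒n<m (n>0⇒n≢0 (≤-trans (k≤n⇒nCk>0 (m≤n+m (suc m) s)) binomial≤)))

  Covering⇒ceilDiv≤occ : Covering (suc m) (suc s) w →
    ∀ a → ceilDiv ((s + suc m) C m) (suc m) ≤ occ a w
  Covering⇒ceilDiv≤occ cov a = ceilDiv-≤ (begin
    (s + suc m) C m                               ≡⟨ entrySum-parikhVectors s m a ⟨
    entrySum a V                                  ≤⟨ sum-map-mono-⊆ (λ p → lookup p a) V-unique
                                                       (Covering⇒parikhVectors⊆windowPVs cov) ⟩
    entrySum a (windowPVs (suc m) w)              ≤⟨ entrySum-windowPVs-≤ a m w ⟩
    suc m * occ a w                               ≡⟨ *-comm (suc m) (occ a w) ⟩
    occ a w * suc m                               ∎)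
    where open ≤-Reasoning

  Covering⇒σ*ceilDiv≤length : Covering (suc m) (suc s) w →
    suc s * ceilDiv ((s + suc m) C m) (suc m) ≤ length w
  Covering⇒σ*ceilDiv≤length cov =
    ≤-trans (order-tabulate-≥ (λ a → occ a w) (Covering⇒ceilDiv≤occ cov)) (≤-reflexive (order-pv w))

  PdB⇒length≤binomial+m : PdB (suc m) (suc s) w → length w ≤ (s + suc m) C suc m + m
  PdB⇒length≤binomial+m pdb = begin
    length w                                   ≤⟨ m≤n+m∸n (length w) m ⟩
    m + (length w ∸ m)                         ≡⟨ cong (m +_) (length-applyUpTo _ _) ⟨
    m + length (windowPVs (suc m) w)
      ≤⟨ +-monoʳ-≤ m (length-mono-⊆ (PdB⇒Unique-windowPVs pdb) (windowPVs⊆parikhVectors (suc m) w)) ⟩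
    m + length V                               ≡⟨ cong (m +_) (length-parikhVectors s (suc m)) ⟩
    m + (s + suc m) C suc m                    ≡⟨ +-comm m _ ⟩
    (s + suc m) C suc m + m                    ∎
    where open ≤-Reasoning

theorem4 : (k σ : ℕ) → 1 ≤ k → 1 ≤ σ →
    ((w : Str σ) → Covering k σ w →
      ((σ + k ∸ 1) C k + k ∸ 1) ⊔ (σ * ceilDiv ((σ + k ∸ 1) C (k ∸ 1)) k) ≤ length w)
    × ((w : Str σ) → PdB k σ w →
      σ * ceilDiv ((σ + k ∸ 1) C (k ∸ 1)) k ≤ (σ + k ∸ 1) C k + k ∸ 1)
theorem4 (suc m) (suc s) _ _ =
  (λ w cov → ⊔-lub (≤-trans (≤-reflexive N+k∸1≡N+m) (Covering⇒binomial+m≤length cov))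
                   (Covering⇒σ*ceilDiv≤length cov)) ,
  (λ w pdb → ≤-trans (Covering⇒σ*ceilDiv≤length (PdB⇒Covering pdb))
                     (≤-trans (PdB⇒length≤binomial+m pdb) (≤-reflexive (sym N+k∸1≡N+m))))
  where
  N+k∸1≡N+m : (s + suc m) C suc m + suc m ∸ 1 ≡ (s + suc m) C suc m + m
  N+k∸1≡N+m = cong (_∸ 1) (+-suc ((s + suc m) C suc m) m)
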